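{- In every Knödel graph $W_{\Delta,n}$, $d(u_0,u_i)=d(u_0,u_{n/2-i})$ for all $i=1,2,\dots,\lfloor n/4\rfloor$.
   Context: Knödel graph: for an even integer $n$ and an integer $\Delta$ with $1\le\Delta\le\lfloor\log_2 n\rfloor$, $W_{\Delta,n}$ is the simple bipartite graph with vertex set $U\cup V$, where $U=\{u_0,\dots,u_{n/2-1}\}$ and $V=\{v_0,\dots,v_{n/2-1}\}$; indices are read modulo $n/2$. The vertices $u_i$ and $v_j$ are adjacent iff $j-i\equiv 2^k-1\pmod{n/2}$ for some $k\in\{0,\dots,\Delta-1\}$; no other edges. $d(x,y)$ denotes the graph distance (length of a shortest $x$–$y$ path). -}

module Defs where

open import Data.Nat using (ℕ; zero; suc; _+_; _*_; _∸_; _^_; _≤_; _<_; NonZero)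
open import Data.Nat.DivMod using (_%_)
open import Data.Bool using (Bool; true; false)
open import Data.Product using (Σ; ∃-syntax; _×_; _,_)
open import Relation.Binary.PropositionalEquality using (_≡_)

-- The Knödel graph W_{Δ,n} with n = 2 * m (m = n/2 ≥ 1).
-- A vertex is a pair (side , index): side true = u_index, side false = v_index,
-- index a natural number < m.
Vertex : ℕ → Set
Vertex m = Bool × ℕ

-- u_i and v_j adjacent iff j - i ≡ 2^k - 1 (mod m) for some k < Δ,
-- i.e. (j + m - i) % m ≡ (2^k - 1) % m  (with i < m).
UVAdj : (m : ℕ) .{{_ : NonZero m}} → (Δ i j : ℕ) → Set
UVAdj m Δ i j = ∃[ k ] (k < Δ × ((j + m ∸ i) % m ≡ (2 ^ k ∸ 1) % m))

data Adj (m : ℕ) .{{_ : NonZero m}} (Δ : ℕ) : Vertex m → Vertex m → Set where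
  uv : ∀ {i j} → i < m → j < m → UVAdj m Δ i j → Adj m Δ (true , i) (false , j)
  vu : ∀ {i j} → i < m → j < m → UVAdj m Δ i j → Adj m Δ (false , j) (true , i)

data Walk (m : ℕ) .{{_ : NonZero m}} (Δ : ℕ) : Vertex m → Vertex m → ℕ → Set where
  here : ∀ {x} → Walk m Δ x x 0
  step : ∀ {x y z ℓ} → Adj m Δ x y → Walk m Δ y z ℓ → Walk m Δ x z (suc ℓ)

IsDist : (m : ℕ) .{{_ : NonZero m}} (Δ : ℕ) → Vertex m → Vertex m → ℕ → Set
IsDist m Δ x y ℓ = Walk m Δ x y ℓ × (∀ ℓ' → Walk m Δ x y ℓ' → ℓ ≤ ℓ')

u : (m : ℕ) → ℕ → Vertex m
u m i = (true , i)

module Submission where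

-- Write uₐ, vₐ with indices in ℤ/m.  Whether u_i ~ v_j depends only on
-- the offset j - i (mod m), so every rotation x_j ↦ x_{j+c} is a graph
-- automorphism.  Reversing a walk u₀ → uₐ and rotating it by c = m - a turns
-- it into a walk of the same length from u_{a+c} = u₀ to u_c = u_{m-a}.  Walks
-- therefore correspond length-for-length in both directions, and so do
-- distances.

open import Defs
open import Data.Nat using (ℕ; _+_; _*_; _∸_; _^_; _≤_; NonZero)
open import Function.Bundles using (_⇔_)
open import Relation.Binary.PropositionalEquality using (_≡_)

open import Data.Nat using (suc; _<_)
open import Data.Nat.Properties
  using (+-comm; +-identityʳ; +-commutativeSemigroup; +-∸-assoc; m+[n∸m]≡n;
         m∸n+n≡m; m<m+n; ≤-trans; ≤-reflexive; <⇒≤; ∸-monoʳ-<)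
open import Data.Nat.DivMod using (_%_; %-distribˡ-+; m%n%n≡m%n; [m+n]%n≡m%n; n%n≡0; m%n≤n; m%n<n; m<n⇒m%n≡m)
open import Algebra.Properties.CommutativeSemigroup +-commutativeSemigroup using (x∙yz≈y∙xz; xy∙z≈y∙xz; xy∙z≈xz∙y)
open import Data.Bool using (true)
open import Data.Product using (_,_)
open import Relation.Binary.PropositionalEquality using (sym; trans; cong; subst; subst₂; module ≡-Reasoning)
open import Function.Bundles using (mk⇔)

module OffsetArithmetic (m : ℕ) .{{_ : NonZero m}} where
  open ≡-Reasoning

  -- The offset from a to b modulo m, i.e. the residue of b - a.  Adjacency
  -- u_i ~ v_j in W_{Δ,2m} is a condition on offset i j alone.
  offset : ℕ → ℕ → ℕ
  offset a b = (b + m ∸ a) % m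

  %-absorbˡ : ∀ x y → (x % m + y) % m ≡ (x + y) % m
  %-absorbˡ x y = begin
    (x % m + y) % m             ≡⟨ %-distribˡ-+ (x % m) y m ⟩
    (x % m % m + y % m) % m     ≡⟨ cong (λ t → (t + y % m) % m) (m%n%n≡m%n x m) ⟩
    (x % m + y % m) % m         ≡⟨ sym (%-distribˡ-+ x y m) ⟩
    (x + y) % m                 ∎

  %-absorbʳ : ∀ x y → (x + y % m) % m ≡ (x + y) % m
  %-absorbʳ x y = begin
    (x + y % m) % m   ≡⟨ cong (_% m) (+-comm x (y % m)) ⟩
    (y % m + x) % m   ≡⟨ %-absorbˡ y x ⟩
    (y + x) % m       ≡⟨ cong (_% m) (+-comm y x) ⟩
    (x + y) % m       ∎

  -- For a ≤ m the truncated subtraction in the offset is harmless.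
  offset-≡ : ∀ {a} b → a ≤ m → offset a b ≡ (b + (m ∸ a)) % m
  offset-≡ b a≤m = cong (_% m) (+-∸-assoc b a≤m)

  offset-inverseʳ : ∀ {a} b → a ≤ m → (a + offset a b) % m ≡ b % m
  offset-inverseʳ {a} b a≤m = begin
    (a + offset a b) % m           ≡⟨ cong (λ t → (a + t) % m) (offset-≡ b a≤m) ⟩
    (a + (b + (m ∸ a)) % m) % m    ≡⟨ %-absorbʳ a (b + (m ∸ a)) ⟩
    (a + (b + (m ∸ a))) % m        ≡⟨ cong (_% m) (x∙yz≈y∙xz a b (m ∸ a)) ⟩
    (b + (a + (m ∸ a))) % m        ≡⟨ cong (λ t → (b + t) % m) (m+[n∸m]≡n a≤m) ⟩
    (b + m) % m                    ≡⟨ [m+n]%n≡m%n b m ⟩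
    b % m                          ∎

  offset-inverseˡ : ∀ {a} r → a ≤ m → offset a ((a + r) % m) ≡ r % m
  offset-inverseˡ {a} r a≤m = begin
    offset a ((a + r) % m)         ≡⟨ offset-≡ ((a + r) % m) a≤m ⟩
    ((a + r) % m + (m ∸ a)) % m    ≡⟨ %-absorbˡ (a + r) (m ∸ a) ⟩
    (a + r + (m ∸ a)) % m          ≡⟨ cong (_% m) (xy∙z≈y∙xz a r (m ∸ a)) ⟩
    (r + (a + (m ∸ a))) % m        ≡⟨ cong (λ t → (r + t) % m) (m+[n∸m]≡n a≤m) ⟩
    (r + m) % m                    ≡⟨ [m+n]%n≡m%n r m ⟩
    r % m                          ∎

  offset-shift : ∀ {a} b c → a ≤ m → offset ((a + c) % m) ((b + c) % m) ≡ offset a b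
  offset-shift {a} b c a≤m = begin
    offset a′ ((b + c) % m)        ≡⟨ cong (offset a′) shifted-target ⟩
    offset a′ ((a′ + r) % m)       ≡⟨ offset-inverseˡ r (m%n≤n (a + c) m) ⟩
    r % m                          ≡⟨ m%n%n≡m%n (b + m ∸ a) m ⟩
    r                              ∎
    where
    a′ : ℕ
    a′ = (a + c) % m
    r : ℕ
    r = offset a b
    shifted-target : (b + c) % m ≡ (a′ + r) % m
    shifted-target = begin
      (b + c) % m                  ≡⟨ sym (%-absorbˡ b c) ⟩
      (b % m + c) % m              ≡⟨ cong (λ t → (t + c) % m) (sym (offset-inverseʳ b a≤m)) ⟩
      ((a + r) % m + c) % m        ≡⟨ %-absorbˡ (a + r) c ⟩
      (a + r + c) % m              ≡⟨ cong (_% m) (xy∙z≈xz∙y a r c) ⟩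
      (a + c + r) % m              ≡⟨ sym (%-absorbˡ (a + c) r) ⟩
      (a′ + r) % m                 ∎

module WalkSymmetries (m : ℕ) .{{_ : NonZero m}} (Δ : ℕ) where
  open OffsetArithmetic m

  rotate : ℕ → Vertex m → Vertex m
  rotate c (s , j) = (s , (j + c) % m)

  uvAdj-rotate : ∀ c {i j} → i < m → UVAdj m Δ i j → UVAdj m Δ ((i + c) % m) ((j + c) % m)
  uvAdj-rotate c {i} {j} i<m (k , k<Δ , offset≡) = k , k<Δ , trans (offset-shift j c (<⇒≤ i<m)) offset≡

  adj-rotate : ∀ c {x y} → Adj m Δ x y → Adj m Δ (rotate c x) (rotate c y)
  adj-rotate c (uv {i} {j} i<m j<m a) = uv (m%n<n (i + c) m) (m%n<n (j + c) m) (uvAdj-rotate c i<m a)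
  adj-rotate c (vu {i} {j} i<m j<m a) = vu (m%n<n (i + c) m) (m%n<n (j + c) m) (uvAdj-rotate c i<m a)

  walk-rotate : ∀ c {x y ℓ} → Walk m Δ x y ℓ → Walk m Δ (rotate c x) (rotate c y) ℓ
  walk-rotate c here       = here
  walk-rotate c (step e w) = step (adj-rotate c e) (walk-rotate c w)

  adj-sym : ∀ {x y} → Adj m Δ x y → Adj m Δ y x
  adj-sym (uv i<m j<m a) = vu i<m j<m a
  adj-sym (vu i<m j<m a) = uv i<m j<m a

  walk-snoc : ∀ {x y z ℓ} → Walk m Δ x y ℓ → Adj m Δ y z → Walk m Δ x z (suc ℓ)
  walk-snoc here       e = step e here
  walk-snoc (step f w) e = step f (walk-snoc w e)

  walk-reverse : ∀ {x y ℓ} → Walk m Δ x y ℓ → Walk m Δ y x ℓ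
  walk-reverse here       = here
  walk-reverse (step e w) = walk-snoc (walk-reverse w) (adj-sym e)

  -- If a + b = m then u_b mirrors u_a: reverse a walk u₀ → uₐ and rotate it by b.
  walk-mirror : ∀ {a b ℓ} → a + b ≡ m → b < m → Walk m Δ (u m 0) (u m a) ℓ → Walk m Δ (u m 0) (u m b) ℓ
  walk-mirror {a} {b} {ℓ} a+b≡m b<m w =
    subst₂ (λ p q → Walk m Δ (true , p) (true , q) ℓ) start≡0 (m<n⇒m%n≡m b<m) (walk-rotate b (walk-reverse w))
    where
    start≡0 : (a + b) % m ≡ 0
    start≡0 = trans (cong (_% m) a+b≡m) (n%n≡0 m)

  isDist-transfer : ∀ {x y x′ y′ ℓ} → (∀ {k} → Walk m Δ x y k → Walk m Δ x′ y′ k)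
                  → (∀ {k} → Walk m Δ x′ y′ k → Walk m Δ x y k)
                  → IsDist m Δ x y ℓ ⇔ IsDist m Δ x′ y′ ℓ
  isDist-transfer to from = mk⇔ (λ (w , shortest) → to w , λ k w′ → shortest k (from w′))
                                (λ (w , shortest) → from w , λ k w′ → shortest k (to w′))

  dist-mirror : ∀ {a ℓ} → 0 < a → a < m → IsDist m Δ (u m 0) (u m a) ℓ ⇔ IsDist m Δ (u m 0) (u m (m ∸ a)) ℓ
  dist-mirror {a} 0<a a<m =
    isDist-transfer (walk-mirror (m+[n∸m]≡n a≤m) (∸-monoʳ-< 0<a a≤m))
                    (walk-mirror (m∸n+n≡m a≤m) a<m)
    where
    a≤m : a ≤ m
    a≤m = <⇒≤ a<m

mainTheorem3 : (n Δ : ℕ) → (m : ℕ) → .{{_ : NonZero m}} → n ≡ 2 * m → 1 ≤ Δ → 2 ^ Δ ≤ n → (i : ℕ) → 1 ≤ i → 2 * i ≤ m → (ℓ : ℕ) → IsDist m Δ (u m 0) (u m i) ℓ ⇔ IsDist m Δ (u m 0) (u m (m ∸ i)) ℓ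
mainTheorem3 _ Δ m _ _ _ i 1≤i 2i≤m _ = WalkSymmetries.dist-mirror m Δ 1≤i i<m
  where
  -- i < i + i = 2i ≤ m
  i<m : i < m
  i<m = ≤-trans (m<m+n i 1≤i) (≤-trans (≤-reflexive (cong (i +_) (sym (+-identityʳ i)))) 2i≤m)
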